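{- Let $\alpha=(\sqrt{13}-1)/2$, $A(n)=\lfloor n\alpha\rfloor$ for $n\ge1$, and let $\Delta AA=(A(A(n+1))-A(A(n)))_{n\ge1}=11312221222\cdots$ (viewed as an infinite word). Let $\theta$ be the morphism on $\{1,\dots,6\}$ given by $\theta(1)=123$, $\theta(2)=164$, $\theta(3)=5145$, $\theta(4)=1645$, $\theta(5)=123$, $\theta(6)=164$, and let $\lambda$ be the letter-to-letter map $1\mapsto1$, $2\mapsto1$, $3\mapsto 3$, $4\mapsto2$, $5\mapsto2$, $6\mapsto2$. Then $\Delta AA=\lambda(\theta^{\infty}(1))$.
   Context: $\theta^{\infty}(1)$ denotes the infinite fixed point of $\theta$ starting with the letter $1$, i.e., the limit of the words $\theta^n(1)$; $\lambda$ is applied letterwise. -}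

module Defs where

open import Data.Nat using (ℕ; zero; suc; _+_; _*_; _≤_; _<_)
open import Data.Product using (_×_)
open import Data.List using (List; []; _∷_; concatMap)

-- α = (√13 - 1)/2.  For n ≥ 1 and m : ℕ we have
--   m = ⌊ n α ⌋  ⇔  m ≤ n α < m + 1
--                ⇔  2m + n ≤ n √13 < 2(m+1) + n
--                ⇔  (2m + n)² ≤ 13 n² < (2m + 2 + n)²
-- (all quantities are nonnegative, so squaring is order-preserving).
IsFloorNAlpha : ℕ → ℕ → Set
IsFloorNAlpha n m =
  ((2 * m + n) * (2 * m + n) ≤ 13 * (n * n)) ×
  (13 * (n * n) < (2 * m + 2 + n) * (2 * m + 2 + n))

θ : ℕ → List ℕ
θ 1 = 1 ∷ 2 ∷ 3 ∷ []
θ 2 = 1 ∷ 6 ∷ 4 ∷ []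
θ 3 = 5 ∷ 1 ∷ 4 ∷ 5 ∷ []
θ 4 = 1 ∷ 6 ∷ 4 ∷ 5 ∷ []
θ 5 = 1 ∷ 2 ∷ 3 ∷ []
θ 6 = 1 ∷ 6 ∷ 4 ∷ []
θ _ = []   -- letters outside {1,…,6} never occur

θ* : List ℕ → List ℕ
θ* = concatMap θ

θ^_[1] : ℕ → List ℕ
θ^ zero  [1] = 1 ∷ []
θ^ suc k [1] = θ* (θ^ k [1])

lam : ℕ → ℕ
lam 1 = 1
lam 2 = 1
lam 3 = 3
lam 4 = 2
lam 5 = 2
lam 6 = 2
lam _ = 0

-- Put δ x y = 6 (x α − y) ∈ ℤ[√13]; then y = ⌊ x α ⌋ iff 0 < δ x y < 6, and signs in ℤ[√13]
-- can be certified exactly.  The letters 5, 1, 6, 2, 4, 3 label six consecutive intervals of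
-- (0, 6), and the letter of θ^k(1) at position n is the one whose interval contains δ n (A n).
-- Since α² + α = 3, the δ-values of the points (n + 1, A n + d), (A n, 3 n − A n + c) and
-- (2 n + A n − 2 + j, 3 n + A n + c') are affine in δ n (A n), with slopes 1, −(1 + α) and
-- 1 − α.  So the interval of the letter a at n determines A (n + 1) − A n = |θ(a)| − 2 and
-- A (A (n + 1)) − A (A n) = λ(a), as well as A and the letters on the block θ(a), which occupies
-- the positions 2 n + A n − 2 + j; this drives the induction along θ.  Each step is an inclusion
-- of intervals with constant endpoints, checked by evaluation.

module Submission where

open import Defs
open import Data.Nat using (ℕ; _+_; _≤_)
open import Data.Fin using (Fin; toℕ)
import Data.Fin as Fin
open import Data.List using (length; lookup)
open import Relation.Binary.PropositionalEquality using (_≡_)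

open import Data.Nat using (zero; suc; _*_; _<_; _≤ᵇ_; z≤n; s≤s; NonZero; nonTrivial⇒n>1)
import Data.Nat.Properties as ℕₚ
import Data.Nat.Tactic.RingSolver as ℕ-Solver
open import Data.Nat.Divisibility using (_∣_; divides)
open import Data.Nat.Primality using (Prime; prime?; euclidsLemma; prime⇒nonZero; prime⇒nonTrivial)
open import Data.Nat.Induction using (<-rec)
open import Data.Integer as ℤ using (ℤ; +_; -[1+_]; 0ℤ)
import Data.Integer.Properties as ℤₚ
open import Data.Integer.Tactic.RingSolver using (solve; solve-∀)
open import Data.Bool using (Bool; true; false; T; _∧_; _∨_)
open import Data.Bool.Properties using (T-∧; T-∨)
open import Data.Product using (_×_; _,_; proj₁; proj₂)
open import Data.Sum using (_⊎_; inj₁; inj₂; [_,_]′)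
open import Data.Empty using (⊥; ⊥-elim)
open import Data.Unit using (⊤; tt)
open import Data.List using (List; []; _∷_; _++_)
open import Function using (id)
open import Function.Bundles using (Equivalence)
open import Relation.Binary.PropositionalEquality
  using (refl; sym; trans; cong; cong₂; subst; module ≡-Reasoning)
open import Relation.Binary.Definitions using (tri<; tri≈; tri>)
open import Relation.Nullary.Decidable using (from-yes)

open Equivalence using (to)

-- A data type rather than a record, so that nested products reduce to explicit
-- coordinates, which the ring solver needs.
data ℤ[√13] : Set where
  ⟨_+_√13⟩ : ℤ → ℤ → ℤ[√13]

ι : ℤ → ℤ[√13]
ι k = ⟨ k + 0ℤ √13⟩

infixl 6 _⊕_ _⊖_
infixl 7 _⊗_
infix 8 ⊖_

_⊕_ : ℤ[√13] → ℤ[√13] → ℤ[√13]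
⟨ a + b √13⟩ ⊕ ⟨ c + d √13⟩ = ⟨ a ℤ.+ c + b ℤ.+ d √13⟩

⊖_ : ℤ[√13] → ℤ[√13]
⊖ ⟨ a + b √13⟩ = ⟨ ℤ.- a + ℤ.- b √13⟩

_⊖_ : ℤ[√13] → ℤ[√13] → ℤ[√13]
z ⊖ w = z ⊕ ⊖ w

_⊗_ : ℤ[√13] → ℤ[√13] → ℤ[√13]
⟨ a + b √13⟩ ⊗ ⟨ c + d √13⟩ = ⟨ a ℤ.* c ℤ.+ + 13 ℤ.* (b ℤ.* d) + a ℤ.* d ℤ.+ b ℤ.* c √13⟩

-- Positivity

NonZeroNatural : ℤ[√13] → Set
NonZeroNatural ⟨ + a + + b √13⟩ = 1 ≤ a + b
NonZeroNatural _                = ⊥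

-- A certificate for z > 0.  Every positive z has one: z ∣ z ∣ is z², N(z) or −N(z)
-- according to the signs of the coordinates of z, which positive? below exploits.
record Positive (z : ℤ[√13]) : Set where
  constructor positive
  field
    multiplier          : ℤ[√13]
    multiplier-natural  : NonZeroNatural multiplier
    product-natural     : NonZeroNatural (z ⊗ multiplier)

NonNegative : ℤ[√13] → Set
NonNegative z = z ≡ ι 0ℤ ⊎ Positive z

nonZeroNatural-⊕ : ∀ {z w} → NonZeroNatural z → NonZeroNatural w → NonZeroNatural (z ⊕ w)
nonZeroNatural-⊕ {⟨ + a + + b √13⟩} {⟨ + c + + d √13⟩} a+b≥1 _ =
  ℕₚ.≤-trans a+b≥1 (ℕₚ.+-mono-≤ (ℕₚ.m≤m+n a c) (ℕₚ.m≤m+n b d))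

⊗-natural : ∀ a b c d →
  ⟨ + a + + b √13⟩ ⊗ ⟨ + c + + d √13⟩ ≡ ⟨ + (a * c + 13 * (b * d)) + + (a * d + b * c) √13⟩
⊗-natural a b c d = sym (cong₂ ⟨_+_√13⟩
  (cong₂ ℤ._+_ (ℤₚ.pos-* a c) (trans (ℤₚ.pos-* 13 (b * d)) (cong (+ 13 ℤ.*_) (ℤₚ.pos-* b d))))
  (cong₂ ℤ._+_ (ℤₚ.pos-* a d) (ℤₚ.pos-* b c)))

nonZeroNatural-⊗ : ∀ {z w} → NonZeroNatural z → NonZeroNatural w → NonZeroNatural (z ⊗ w)
nonZeroNatural-⊗ {⟨ + a + + b √13⟩} {⟨ + c + + d √13⟩} a+b≥1 c+d≥1 =
  subst NonZeroNatural (sym (⊗-natural a b c d))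
    (ℕₚ.≤-trans (ℕₚ.*-mono-≤ a+b≥1 c+d≥1)
      (ℕₚ.≤-trans (ℕₚ.m≤m+n _ (12 * (b * d))) (ℕₚ.≤-reflexive (expand a b c d))))
  where
  expand : ∀ a b c d → (a + b) * (c + d) + 12 * (b * d) ≡ a * c + 13 * (b * d) + (a * d + b * c)
  expand = ℕ-Solver.solve-∀

nonZeroNatural-⊖ : ∀ {z} → NonZeroNatural z → NonZeroNatural (⊖ z) → ⊥
nonZeroNatural-⊖ {⟨ + suc a + + b √13⟩} _ ()
nonZeroNatural-⊖ {⟨ + zero + + suc b √13⟩} _ ()

⊗-identityʳ : ∀ z → z ⊗ ι (+ 1) ≡ z
⊗-identityʳ ⟨ a + b √13⟩ = cong₂ ⟨_+_√13⟩ (solve (a ∷ b ∷ [])) (solve (a ∷ b ∷ []))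

⊕-identityʳ : ∀ z → z ⊕ ι 0ℤ ≡ z
⊕-identityʳ ⟨ a + b √13⟩ = cong₂ ⟨_+_√13⟩ (ℤₚ.+-identityʳ a) (ℤₚ.+-identityʳ b)

⊗-zeroˡ : ∀ z → ι 0ℤ ⊗ z ≡ ι 0ℤ
⊗-zeroˡ ⟨ a + b √13⟩ = cong₂ ⟨_+_√13⟩ (solve (a ∷ b ∷ [])) (solve (a ∷ b ∷ []))

⊕-⊗-distrib : ∀ z w p q → (z ⊕ w) ⊗ (p ⊗ q) ≡ (z ⊗ p) ⊗ q ⊕ (w ⊗ q) ⊗ p
⊕-⊗-distrib ⟨ a + b √13⟩ ⟨ c + d √13⟩ ⟨ e + f √13⟩ ⟨ g + h √13⟩ =
  cong₂ ⟨_+_√13⟩ (solve (a ∷ b ∷ c ∷ d ∷ e ∷ f ∷ g ∷ h ∷ [])) (solve (a ∷ b ∷ c ∷ d ∷ e ∷ f ∷ g ∷ h ∷ []))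

⊗-interchange : ∀ z w p q → (z ⊗ w) ⊗ (p ⊗ q) ≡ (z ⊗ p) ⊗ (w ⊗ q)
⊗-interchange ⟨ a + b √13⟩ ⟨ c + d √13⟩ ⟨ e + f √13⟩ ⟨ g + h √13⟩ =
  cong₂ ⟨_+_√13⟩ (solve (a ∷ b ∷ c ∷ d ∷ e ∷ f ∷ g ∷ h ∷ [])) (solve (a ∷ b ∷ c ∷ d ∷ e ∷ f ∷ g ∷ h ∷ []))

⊗-rotate : ∀ c z p → (c ⊗ z) ⊗ p ≡ z ⊗ (c ⊗ p)
⊗-rotate ⟨ a + b √13⟩ ⟨ c + d √13⟩ ⟨ e + f √13⟩ =
  cong₂ ⟨_+_√13⟩ (solve (a ∷ b ∷ c ∷ d ∷ e ∷ f ∷ [])) (solve (a ∷ b ∷ c ∷ d ∷ e ∷ f ∷ []))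

⊖-⊗-swap : ∀ z p q → (⊖ z ⊗ q) ⊗ p ≡ ⊖ ((z ⊗ p) ⊗ q)
⊖-⊗-swap ⟨ a + b √13⟩ ⟨ c + d √13⟩ ⟨ e + f √13⟩ =
  cong₂ ⟨_+_√13⟩ (solve (a ∷ b ∷ c ∷ d ∷ e ∷ f ∷ [])) (solve (a ∷ b ∷ c ∷ d ∷ e ∷ f ∷ []))

nonZeroNatural⇒positive : ∀ {z} → NonZeroNatural z → Positive z
nonZeroNatural⇒positive {z} z≠0 =
  positive (ι (+ 1)) (s≤s z≤n) (subst NonZeroNatural (sym (⊗-identityʳ z)) z≠0)

positive-⊕ : ∀ {z w} → Positive z → Positive w → Positive (z ⊕ w)
positive-⊕ {z} {w} (positive p p≠0 zp≠0) (positive q q≠0 wq≠0) =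
  positive (p ⊗ q) (nonZeroNatural-⊗ p≠0 q≠0)
    (subst NonZeroNatural (sym (⊕-⊗-distrib z w p q))
      (nonZeroNatural-⊕ (nonZeroNatural-⊗ zp≠0 q≠0) (nonZeroNatural-⊗ wq≠0 p≠0)))

positive-⊗ : ∀ {z w} → Positive z → Positive w → Positive (z ⊗ w)
positive-⊗ {z} {w} (positive p p≠0 zp≠0) (positive q q≠0 wq≠0) =
  positive (p ⊗ q) (nonZeroNatural-⊗ p≠0 q≠0)
    (subst NonZeroNatural (sym (⊗-interchange z w p q)) (nonZeroNatural-⊗ zp≠0 wq≠0))

positive-⊕-nonNegative : ∀ {z w} → Positive z → NonNegative w → Positive (z ⊕ w)
positive-⊕-nonNegative {z} z>0 (inj₁ refl) = subst Positive (sym (⊕-identityʳ z)) z>0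
positive-⊕-nonNegative z>0 (inj₂ w>0) = positive-⊕ z>0 w>0

positive-cancelˡ : ∀ {c z} → NonZeroNatural c → Positive (c ⊗ z) → Positive z
positive-cancelˡ {c} {z} c≠0 (positive p p≠0 czp≠0) =
  positive (c ⊗ p) (nonZeroNatural-⊗ c≠0 p≠0) (subst NonZeroNatural (⊗-rotate c z p) czp≠0)

positive-asym : ∀ {z} → Positive z → Positive (⊖ z) → ⊥
positive-asym {z} (positive p p≠0 zp≠0) (positive q q≠0 -zq≠0) =
  nonZeroNatural-⊖ (nonZeroNatural-⊗ zp≠0 q≠0)
    (subst NonZeroNatural (⊖-⊗-swap z p q) (nonZeroNatural-⊗ -zq≠0 p≠0))

nonPositive⇒¬positive : ∀ {k} → k ℤ.≤ 0ℤ → Positive (ι k) → ⊥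
nonPositive⇒¬positive {+ zero} _ (positive p _ 0p≠0) = ℕₚ.n≮0 (subst NonZeroNatural (⊗-zeroˡ p) 0p≠0)
nonPositive⇒¬positive { -[1+ k ]} _ k>0 = positive-asym k>0 (nonZeroNatural⇒positive (s≤s z≤n))
nonPositive⇒¬positive {+ suc _} (ℤ.+≤+ ()) _

positive-witness : ∀ {z p} k → NonZeroNatural p → z ⊗ p ≡ ι (+ suc k) → Positive z
positive-witness {p = p} _ p≠0 zp≡k = positive p p≠0 (subst NonZeroNatural (sym zp≡k) (s≤s z≤n))

∣_∣ : ℤ[√13] → ℤ[√13]
∣ ⟨ a + b √13⟩ ∣ = ⟨ + ℤ.∣ a ∣ + + ℤ.∣ b ∣ √13⟩

nonZeroNatural? : ℤ[√13] → Bool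
nonZeroNatural? ⟨ + a + + b √13⟩ = 1 ≤ᵇ a + b
nonZeroNatural? _                = false

nonZeroNatural?-sound : ∀ z → T (nonZeroNatural? z) → NonZeroNatural z
nonZeroNatural?-sound ⟨ + a + + b √13⟩ ok = ℕₚ.≤ᵇ⇒≤ 1 (a + b) ok
nonZeroNatural?-sound ⟨ + _ + -[1+ _ ] √13⟩ ()
nonZeroNatural?-sound ⟨ -[1+ _ ] + _ √13⟩ ()

positive? : ℤ[√13] → Bool
positive? z = nonZeroNatural? ∣ z ∣ ∧ nonZeroNatural? (z ⊗ ∣ z ∣)

positive?-sound : ∀ z → T (positive? z) → Positive z
positive?-sound z ok with to (T-∧ {nonZeroNatural? ∣ z ∣}) ok
... | ∣z∣≠0 , z∣z∣≠0 = positive ∣ z ∣ (nonZeroNatural?-sound _ ∣z∣≠0) (nonZeroNatural?-sound _ z∣z∣≠0)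

isZero? : ℤ[√13] → Bool
isZero? ⟨ + zero + + zero √13⟩ = true
isZero? _                      = false

isZero?-sound : ∀ z → T (isZero? z) → z ≡ ι 0ℤ
isZero?-sound ⟨ + zero + + zero √13⟩ _ = refl
isZero?-sound ⟨ + zero + + suc _ √13⟩ ()
isZero?-sound ⟨ + zero + -[1+ _ ] √13⟩ ()
isZero?-sound ⟨ + suc _ + _ √13⟩ ()
isZero?-sound ⟨ -[1+ _ ] + _ √13⟩ ()

infix 4 _≤?_

_≤?_ : ℤ[√13] → ℤ[√13] → Bool
x ≤? y = isZero? (y ⊖ x) ∨ positive? (y ⊖ x)

≤?-sound : ∀ x y → T (x ≤? y) → NonNegative (y ⊖ x)
≤?-sound x y ok with to (T-∨ {isZero? (y ⊖ x)}) ok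
... | inj₁ y≡x = inj₁ (isZero?-sound (y ⊖ x) y≡x)
... | inj₂ pos  = inj₂ (positive?-sound (y ⊖ x) pos)

-- The floor function of x ↦ x α, α = (√13 − 1) / 2

prime*square≢square : ∀ {p} → Prime p → ∀ x y → p * (x * x) ≡ y * y → x ≡ 0
prime*square≢square {p} p-prime = <-rec (λ x → ∀ y → p * (x * x) ≡ y * y → x ≡ 0) descent
  where
  instance
    p≢0 : NonZero p
    p≢0 = prime⇒nonZero p-prime

  p∣square⇒p∣ : ∀ n → p ∣ n * n → p ∣ n
  p∣square⇒p∣ n p∣n² = [ id , id ]′ (euclidsLemma n n p-prime p∣n²)

  square-* : ∀ n p → (n * p) * (n * p) ≡ p * (p * (n * n))
  square-* = ℕ-Solver.solve-∀

  descent : ∀ x → (∀ {x'} → x' < x → ∀ y → p * (x' * x') ≡ y * y → x' ≡ 0) →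
            ∀ y → p * (x * x) ≡ y * y → x ≡ 0
  descent x rec y eq with p∣square⇒p∣ y (divides (x * x) (trans (sym eq) (ℕₚ.*-comm p _)))
  ... | divides y' refl
    with p∣square⇒p∣ x
           (divides (y' * y') (trans (ℕₚ.*-cancelˡ-≡ _ _ p (trans eq (square-* y' p))) (ℕₚ.*-comm p _)))
  ... | divides zero refl = refl
  ... | divides x'@(suc _) refl =
    cong (_* p) (rec {x'} (ℕₚ.m<m*n x' p (nonTrivial⇒n>1 p {{prime⇒nonTrivial p-prime}})) y'
      (ℕₚ.*-cancelˡ-≡ (p * (x' * x')) (y' * y') p (ℕₚ.*-cancelˡ-≡ _ _ p
        (trans (cong (p *_) (sym (square-* x' p))) (trans eq (square-* y' p))))))

13-prime : Prime 13
13-prime = from-yes (prime? 13)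

-- δ x y = 6 (x α − y)
δ : ℤ → ℤ → ℤ[√13]
δ x y = ⟨ ℤ.- (+ 3 ℤ.* x ℤ.+ + 6 ℤ.* y) + + 3 ℤ.* x √13⟩

Interval : Set
Interval = ℤ[√13] × ℤ[√13]

record Between (I : Interval) (t : ℤ[√13]) : Set where
  constructor between
  field
    above-lower : Positive (t ⊖ proj₁ I)
    below-upper : Positive (proj₂ I ⊖ t)

floorRange : Interval
floorRange = ι 0ℤ , ι (+ 6)

IsFloor : ℤ → ℤ → Set
IsFloor x y = Between floorRange (δ x y)

pos-13-square : ∀ x → + (13 * (x * x)) ≡ + 13 ℤ.* (+ x ℤ.* + x)
pos-13-square x = trans (ℤₚ.pos-* 13 (x * x)) (cong (+ 13 ℤ.*_) (ℤₚ.pos-* x x))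

below-√13 : ∀ x y k → suc (y * y + k) ≡ 13 * (x * x) → Positive ⟨ ℤ.- (+ y) + + x √13⟩
below-√13 zero _ _ ()
below-√13 x@(suc _) y k eq =
  positive-witness {p = ⟨ + y + + x √13⟩} k (ℕₚ.≤-trans (s≤s z≤n) (ℕₚ.m≤n+m x y))
    (cong₂ ⟨_+_√13⟩ (norm (+ x) (+ y) (+ k) eqℤ) (cross (+ x) (+ y)))
  where
  eqℤ : + 1 ℤ.+ (+ y ℤ.* + y ℤ.+ + k) ≡ + 13 ℤ.* (+ x ℤ.* + x)
  eqℤ = trans (cong (λ s → + 1 ℤ.+ (s ℤ.+ + k)) (sym (ℤₚ.pos-* y y)))
              (trans (cong +_ eq) (pos-13-square x))
  norm : ∀ X Y K → + 1 ℤ.+ (Y ℤ.* Y ℤ.+ K) ≡ + 13 ℤ.* (X ℤ.* X) →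
         ℤ.- Y ℤ.* Y ℤ.+ + 13 ℤ.* (X ℤ.* X) ≡ + 1 ℤ.+ K
  norm X Y K eq = trans (cong (λ s → ℤ.- Y ℤ.* Y ℤ.+ s) (sym eq)) (solve (X ∷ Y ∷ K ∷ []))
  cross : ∀ X Y → ℤ.- Y ℤ.* X ℤ.+ X ℤ.* Y ≡ 0ℤ
  cross = solve-∀

above-√13 : ∀ x y k → suc (13 * (x * x) + k) ≡ y * y → Positive ⟨ + y + ℤ.- (+ x) √13⟩
above-√13 _ zero _ ()
above-√13 x y@(suc _) k eq =
  positive-witness {p = ⟨ + y + + x √13⟩} k (ℕₚ.≤-trans (s≤s z≤n) (ℕₚ.m≤m+n y x))
    (cong₂ ⟨_+_√13⟩ (norm (+ x) (+ y) (+ k) eqℤ) (cross (+ x) (+ y)))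
  where
  eqℤ : + 1 ℤ.+ (+ 13 ℤ.* (+ x ℤ.* + x) ℤ.+ + k) ≡ + y ℤ.* + y
  eqℤ = trans (cong (λ s → + 1 ℤ.+ (s ℤ.+ + k)) (sym (pos-13-square x)))
              (trans (cong +_ eq) (ℤₚ.pos-* y y))
  norm : ∀ X Y K → + 1 ℤ.+ (+ 13 ℤ.* (X ℤ.* X) ℤ.+ K) ≡ Y ℤ.* Y →
         Y ℤ.* Y ℤ.+ + 13 ℤ.* (ℤ.- X ℤ.* X) ≡ + 1 ℤ.+ K
  norm X Y K eq = trans (cong (λ s → s ℤ.+ + 13 ℤ.* (ℤ.- X ℤ.* X)) (sym eq)) (solve (X ∷ Y ∷ K ∷ []))
  cross : ∀ X Y → Y ℤ.* X ℤ.+ ℤ.- X ℤ.* Y ≡ 0ℤ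
  cross = solve-∀

δ>0 : ∀ n m k → suc ((2 * m + n) * (2 * m + n) + k) ≡ 13 * (n * n) →
      Positive (δ (+ n) (+ m) ⊖ ι 0ℤ)
δ>0 n m k eq = subst Positive (scale (+ n) (+ m) _ (ℤₚ.pos-* 2 m))
  (positive-⊗ {ι (+ 3)} (nonZeroNatural⇒positive (s≤s z≤n)) (below-√13 n (2 * m + n) k eq))
  where
  scale : ∀ x y 2y → 2y ≡ + 2 ℤ.* y → ι (+ 3) ⊗ ⟨ ℤ.- (2y ℤ.+ x) + x √13⟩ ≡ δ x y ⊖ ι 0ℤ
  scale x y _ refl = cong₂ ⟨_+_√13⟩ (solve (x ∷ y ∷ [])) (solve (x ∷ y ∷ []))

δ<6 : ∀ n m k → suc (13 * (n * n) + k) ≡ (2 * m + 2 + n) * (2 * m + 2 + n) →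
      Positive (ι (+ 6) ⊖ δ (+ n) (+ m))
δ<6 n m k eq = subst Positive (scale (+ n) (+ m) _ (ℤₚ.pos-* 2 m))
  (positive-⊗ {ι (+ 3)} (nonZeroNatural⇒positive (s≤s z≤n)) (above-√13 n (2 * m + 2 + n) k eq))
  where
  scale : ∀ x y 2y → 2y ≡ + 2 ℤ.* y → ι (+ 3) ⊗ ⟨ 2y ℤ.+ + 2 ℤ.+ x + ℤ.- x √13⟩ ≡ ι (+ 6) ⊖ δ x y
  scale x y _ refl = cong₂ ⟨_+_√13⟩ (solve (x ∷ y ∷ [])) (solve (x ∷ y ∷ []))

isFloor : ∀ n m → 1 ≤ n → IsFloorNAlpha n m → IsFloor (+ n) (+ m)
isFloor n m n≥1 (lower , upper) =
  between (δ>0 n m (proj₁ gap₁) (proj₂ gap₁)) (δ<6 n m (proj₁ gap₂) (proj₂ gap₂))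
  where
  -- equality in the lower bound would make √13 rational
  strict : (2 * m + n) * (2 * m + n) < 13 * (n * n)
  strict = ℕₚ.≤∧≢⇒< lower λ eq → ℕₚ.<⇒≢ n≥1 (sym (prime*square≢square 13-prime n (2 * m + n) (sym eq)))
  gap₁ = ℕₚ.m≤n⇒∃[o]m+o≡n strict
  gap₂ = ℕₚ.m≤n⇒∃[o]m+o≡n upper

floor-gap : ∀ {x y y'} → IsFloor x y → IsFloor x y' → y ℤ.< y' → ⊥
floor-gap {x} {y} {y'} (between _ below6) (between above0 _) y<y' =
  nonPositive⇒¬positive (ℤₚ.i≤j⇒i-j≤0 (ℤₚ.i<j⇒suc[i]≤j y<y'))
    (positive-cancelˡ {ι (+ 6)} (s≤s z≤n) (subst Positive (gap x y y') (positive-⊕ below6 above0)))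
  where
  gap : ∀ x y y' → (ι (+ 6) ⊖ δ x y) ⊕ (δ x y' ⊖ ι 0ℤ) ≡ ι (+ 6) ⊗ ι (+ 1 ℤ.+ y ℤ.- y')
  gap x y y' = cong₂ ⟨_+_√13⟩ (solve (x ∷ y ∷ y' ∷ [])) (solve (x ∷ y ∷ y' ∷ []))

floor-unique : ∀ {x y y'} → IsFloor x y → IsFloor x y' → y ≡ y'
floor-unique {y = y} {y'} f f' with ℤₚ.<-cmp y y'
... | tri< y<y' _ _ = ⊥-elim (floor-gap f f' y<y')
... | tri≈ _ y≡y' _ = y≡y'
... | tri> _ _ y>y' = ⊥-elim (floor-gap f' f y>y')

-- Images of intervals

infix 4 _⊆?_

_⊆?_ : Interval → Interval → Bool
(l , u) ⊆? (l' , u') = (l' ≤? l) ∧ (u ≤? u')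

translate : ℤ[√13] → Interval → Interval
translate d (l , u) = d ⊕ l , d ⊕ u

-- the image of (l , u) under t ↦ h t + e, for h < 0
reflect : ℤ[√13] → ℤ[√13] → Interval → Interval
reflect h e (l , u) = h ⊗ u ⊕ e , h ⊗ l ⊕ e

double : Interval → Interval
double (l , u) = ι (+ 2) ⊗ l , ι (+ 2) ⊗ u

⊕-comm : ∀ z w → z ⊕ w ≡ w ⊕ z
⊕-comm ⟨ a + b √13⟩ ⟨ c + d √13⟩ = cong₂ ⟨_+_√13⟩ (ℤₚ.+-comm a c) (ℤₚ.+-comm b d)

⊖-split : ∀ t m l → t ⊖ l ≡ (t ⊖ m) ⊕ (m ⊖ l)
⊖-split ⟨ a + b √13⟩ ⟨ c + d √13⟩ ⟨ e + f √13⟩ =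
  cong₂ ⟨_+_√13⟩ (solve (a ∷ b ∷ c ∷ d ∷ e ∷ f ∷ [])) (solve (a ∷ b ∷ c ∷ d ∷ e ∷ f ∷ []))

⊕-⊖-cancelˡ : ∀ d t l → (d ⊕ t) ⊖ (d ⊕ l) ≡ t ⊖ l
⊕-⊖-cancelˡ ⟨ a + b √13⟩ ⟨ c + d √13⟩ ⟨ e + f √13⟩ =
  cong₂ ⟨_+_√13⟩ (solve (a ∷ b ∷ c ∷ d ∷ e ∷ f ∷ [])) (solve (a ∷ b ∷ c ∷ d ∷ e ∷ f ∷ []))

⊗-⊖-distribˡ : ∀ c t l → c ⊗ t ⊖ c ⊗ l ≡ c ⊗ (t ⊖ l)
⊗-⊖-distribˡ ⟨ a + b √13⟩ ⟨ c + d √13⟩ ⟨ e + f √13⟩ =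
  cong₂ ⟨_+_√13⟩ (solve (a ∷ b ∷ c ∷ d ∷ e ∷ f ∷ [])) (solve (a ∷ b ∷ c ∷ d ∷ e ∷ f ∷ []))

affine-⊖ : ∀ h e t l → (h ⊗ t ⊕ e) ⊖ (h ⊗ l ⊕ e) ≡ ⊖ h ⊗ (l ⊖ t)
affine-⊖ ⟨ a + b √13⟩ ⟨ c + d √13⟩ ⟨ e + f √13⟩ ⟨ g + h √13⟩ =
  cong₂ ⟨_+_√13⟩ (solve (a ∷ b ∷ c ∷ d ∷ e ∷ f ∷ g ∷ h ∷ [])) (solve (a ∷ b ∷ c ∷ d ∷ e ∷ f ∷ g ∷ h ∷ []))

⊖-antisym : ∀ l t → l ⊖ t ≡ ⊖ (t ⊖ l)
⊖-antisym ⟨ a + b √13⟩ ⟨ c + d √13⟩ =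
  cong₂ ⟨_+_√13⟩ (solve (a ∷ b ∷ c ∷ d ∷ [])) (solve (a ∷ b ∷ c ∷ d ∷ []))

between-empty : ∀ {l t} → Between (l , l) t → ⊥
between-empty {l} {t} (between t>l l>t) = positive-asym t>l (subst Positive (⊖-antisym l t) l>t)

between-⊆ : ∀ {I J t} → T (I ⊆? J) → Between I t → Between J t
between-⊆ {l , u} {l' , u'} {t} I⊆J (between t>l u>t) with to (T-∧ {l' ≤? l}) I⊆J
... | l≥l' , u≤u' = between
  (subst Positive (sym (⊖-split t l l')) (positive-⊕-nonNegative t>l (≤?-sound l' l l≥l')))
  (subst Positive (sym (trans (⊖-split u' u t) (⊕-comm (u' ⊖ u) (u ⊖ t))))
    (positive-⊕-nonNegative u>t (≤?-sound u u' u≤u')))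

between-translate : ∀ {l u t} d → Between (l , u) t → Between (translate d (l , u)) (d ⊕ t)
between-translate {l} {u} {t} d (between t>l u>t) =
  between (subst Positive (sym (⊕-⊖-cancelˡ d t l)) t>l) (subst Positive (sym (⊕-⊖-cancelˡ d u t)) u>t)

between-reflect : ∀ {l u t h} e → Positive (⊖ h) → Between (l , u) t →
                  Between (reflect h e (l , u)) (h ⊗ t ⊕ e)
between-reflect {l} {u} {t} {h} e h<0 (between t>l u>t) = between
  (subst Positive (sym (affine-⊖ h e t u)) (positive-⊗ h<0 u>t))
  (subst Positive (sym (affine-⊖ h e l t)) (positive-⊗ h<0 t>l))

between-halve : ∀ {l u t} → Between (double (l , u)) (ι (+ 2) ⊗ t) → Between (l , u) t
between-halve {l} {u} {t} (between 2t>2l 2u>2t) = between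
  (positive-cancelˡ (s≤s z≤n) (subst Positive (⊗-⊖-distribˡ (ι (+ 2)) t l) 2t>2l))
  (positive-cancelˡ (s≤s z≤n) (subst Positive (⊗-⊖-distribˡ (ι (+ 2)) u t) 2u>2t))

δ-+ : ∀ x y x' y' → δ (x ℤ.+ x') (y ℤ.+ y') ≡ δ x y ⊕ δ x' y'
δ-+ x y x' y' = cong₂ ⟨_+_√13⟩ (solve (x ∷ y ∷ x' ∷ y' ∷ [])) (solve (x ∷ y ∷ x' ∷ y' ∷ []))

-- Since α² + α = 3, (x, y) ↦ (y, 3x − y) multiplies x α − y by −(1 + α) = κ / 2
-- and (x, y) ↦ (2x + y, 3x + y) multiplies it by 1 − α = μ / 2.
κ μ : ℤ[√13]
κ = ⟨ -[1+ 0 ] + -[1+ 0 ] √13⟩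
μ = ⟨ + 3 + -[1+ 0 ] √13⟩

δ-κ : ∀ x y dx dy →
  ι (+ 2) ⊗ δ (dx ℤ.+ y) (dy ℤ.+ (+ 3 ℤ.* x ℤ.- y)) ≡ κ ⊗ δ x y ⊕ ι (+ 2) ⊗ δ dx dy
δ-κ x y dx dy = cong₂ ⟨_+_√13⟩ (solve (x ∷ y ∷ dx ∷ dy ∷ [])) (solve (x ∷ y ∷ dx ∷ dy ∷ []))

δ-μ : ∀ x y dx dy →
  ι (+ 2) ⊗ δ (dx ℤ.+ (+ 2 ℤ.* x ℤ.+ y)) (dy ℤ.+ (+ 3 ℤ.* x ℤ.+ y)) ≡ μ ⊗ δ x y ⊕ ι (+ 2) ⊗ δ dx dy
δ-μ x y dx dy = cong₂ ⟨_+_√13⟩ (solve (x ∷ y ∷ dx ∷ dy ∷ [])) (solve (x ∷ y ∷ dx ∷ dy ∷ []))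

κ<0 : Positive (⊖ κ)
κ<0 = nonZeroNatural⇒positive (s≤s z≤n)

μ<0 : Positive (⊖ μ)
μ<0 = positive?-sound _ _

translate-into : ∀ {I J t t'} d → t' ≡ d ⊕ t → T (translate d I ⊆? J) → Between I t → Between J t'
translate-into d refl I+d⊆J t∈I = between-⊆ I+d⊆J (between-translate d t∈I)

reflect-into : ∀ {I J t t' h} e → Positive (⊖ h) → ι (+ 2) ⊗ t' ≡ h ⊗ t ⊕ e →
               T (reflect h e I ⊆? double J) → Between I t → Between J t'
reflect-into e h<0 2t'≡ hI+e⊆2J t∈I =
  between-halve (subst (Between _) (sym 2t'≡) (between-⊆ hI+e⊆2J (between-reflect e h<0 t∈I)))

-- Numbers that are not letters get the empty interval.
interval : ℕ → Interval
interval 5 = ι 0ℤ                      , ⟨ + 8 + -[1+ 1 ] √13⟩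
interval 1 = ⟨ + 8 + -[1+ 1 ] √13⟩     , ⟨ -[1+ 0 ] + + 1 √13⟩
interval 6 = ⟨ -[1+ 0 ] + + 1 √13⟩     , ⟨ + 7 + -[1+ 0 ] √13⟩
interval 2 = ⟨ + 7 + -[1+ 0 ] √13⟩     , ⟨ + 15 + -[1+ 2 ] √13⟩
interval 4 = ⟨ + 15 + -[1+ 2 ] √13⟩    , ⟨ -[1+ 1 ] + + 2 √13⟩
interval 3 = ⟨ -[1+ 1 ] + + 2 √13⟩     , ι (+ 6)
interval _ = ι 0ℤ                      , ι 0ℤ

-- A (n + 1) − A n for the letter a at n
jump : ℕ → ℤ
jump a = + length (θ a) ℤ.- + 2

-- A (A n) − (3 n − A n) for the letter a at n
offsetAA : ℕ → ℤ
offsetAA 1 = -[1+ 0 ]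
offsetAA 2 = -[1+ 1 ]
offsetAA 3 = -[1+ 2 ]
offsetAA 4 = -[1+ 1 ]
offsetAA 5 = -[1+ 0 ]
offsetAA 6 = -[1+ 1 ]
offsetAA _ = 0ℤ

-- θ a, for the letter a at n, occupies the positions 2 n + A n − 2 + j, and
-- A (2 n + A n − 2 + j) − (3 n + A n) = offsetBlock j
offsetBlock : ℕ → ℤ
offsetBlock 0 = -[1+ 2 ]
offsetBlock 1 = -[1+ 1 ]
offsetBlock 2 = -[1+ 0 ]
offsetBlock _ = + 1

FitsBlock : ℕ → ℕ → List ℕ → Set
FitsBlock a j []      = ⊤
FitsBlock a j (b ∷ w) =
  T (reflect μ (ι (+ 2) ⊗ δ (+ j ℤ.- + 2) (offsetBlock j)) (interval a) ⊆? double (interval b)) ×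
  T (interval b ⊆? floorRange) × FitsBlock a (suc j) w

record Admissible (a : ℕ) : Set where
  field
    next-fits : T (translate (δ (+ 1) (jump a)) (interval a) ⊆? floorRange)
    AA-fits   : T (reflect κ (ι (+ 2) ⊗ δ 0ℤ (offsetAA a)) (interval a) ⊆? double floorRange)
    AA-next-fits :
      T (reflect κ (ι (+ 2) ⊗ δ (jump a) (offsetAA a ℤ.+ + lam a)) (interval a) ⊆? double floorRange)
    block-fits : FitsBlock a 0 (θ a)

-- For an actual letter every field is a closed test that evaluates to true.
admissible : ∀ a {t} → Between (interval a) t → Admissible a
admissible 1 _ = _
admissible 2 _ = _
admissible 3 _ = _
admissible 4 _ = _
admissible 5 _ = _
admissible 6 _ = _
admissible 0 t∈∅ = ⊥-elim (between-empty t∈∅)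
admissible (suc (suc (suc (suc (suc (suc (suc _))))))) t∈∅ = ⊥-elim (between-empty t∈∅)

-- The sequence A

module Floor (A : ℕ → ℕ) (isFloorNAlpha : ∀ n → 1 ≤ n → IsFloorNAlpha n (A n)) where

  A-isFloor : ∀ {n} → 1 ≤ n → IsFloor (+ n) (+ A n)
  A-isFloor {n} n≥1 = isFloor n (A n) n≥1 (isFloorNAlpha n n≥1)

  A-unique : ∀ {n y} → 1 ≤ n → IsFloor (+ n) y → + A n ≡ y
  A-unique {n} n≥1 = floor-unique {+ n} (A-isFloor n≥1)

  A-positive : ∀ {n} → 1 ≤ n → 1 ≤ A n
  A-positive {suc k} _ with A (suc k) | isFloorNAlpha (suc k) (s≤s z≤n)
  ... | suc _ | _         = s≤s z≤n
  ... | zero  | _ , upper = ⊥-elim (ℕₚ.<⇒≱ upper (ℕₚ.≤-trans (ℕₚ.m≤m+n _ _) (ℕₚ.≤-reflexive (expand k))))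
    where
    expand : ∀ k → (3 + k) * (3 + k) + (4 + 20 * k + 12 * (k * k)) ≡ 13 * (suc k * suc k)
    expand = ℕ-Solver.solve-∀

  Placed : ℕ → ℕ → Set
  Placed i a = Between (interval a) (δ (+ i) (+ A i))

  AllPlaced : ℕ → List ℕ → Set
  AllPlaced i []      = ⊤
  AllPlaced i (a ∷ w) = Placed i a × AllPlaced (suc i) w

  position-ℤ : ∀ p j n m → p + 2 ≡ j + (2 * n + m) → + p ≡ (+ j ℤ.- + 2) ℤ.+ (+ 2 ℤ.* + n ℤ.+ + m)
  position-ℤ p j n m eq =
    shift (+ p) (+ j) _ (trans (cong +_ eq) (cong (λ s → + j ℤ.+ (s ℤ.+ + m)) (ℤₚ.pos-* 2 n)))
    where
    shift : ∀ P J X → P ℤ.+ + 2 ≡ J ℤ.+ X → P ≡ (J ℤ.- + 2) ℤ.+ X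
    shift P J X eq = begin
      P                   ≡⟨ solve (P ∷ []) ⟩
      P ℤ.+ + 2 ℤ.- + 2   ≡⟨ cong (λ s → s ℤ.- + 2) eq ⟩
      J ℤ.+ X ℤ.- + 2     ≡⟨ solve (J ∷ X ∷ []) ⟩
      (J ℤ.- + 2) ℤ.+ X   ∎
      where open ≡-Reasoning

  position-positive : ∀ p j n m → 1 ≤ n → 1 ≤ m → p + 2 ≡ j + (2 * n + m) → 1 ≤ p
  position-positive (suc _) _ _ _ _ _ _ = s≤s z≤n
  position-positive zero j n m n≥1 m≥1 eq =
    ⊥-elim (ℕₚ.n≮n 2 (subst (3 ≤_) (sym eq)
      (ℕₚ.≤-trans (ℕₚ.+-mono-≤ (ℕₚ.*-monoʳ-≤ 2 n≥1) m≥1) (ℕₚ.m≤n+m _ j))))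

  module Letter {n a : ℕ} (n≥1 : 1 ≤ n) (placed : Placed n a) where
    open Admissible (admissible a placed)

    A-next-ℤ : + A (suc n) ≡ jump a ℤ.+ + A n
    A-next-ℤ = A-unique (s≤s z≤n)
      (translate-into (δ (+ 1) (jump a)) (δ-+ (+ 1) (jump a) (+ n) (+ A n)) next-fits placed)

    A-next : A (suc n) + 2 ≡ A n + length (θ a)
    A-next = ℤₚ.+-injective (trans (cong (λ s → s ℤ.+ + 2) A-next-ℤ) (cancel (+ length (θ a)) (+ A n)))
      where
      cancel : ∀ L m → L ℤ.- + 2 ℤ.+ m ℤ.+ + 2 ≡ m ℤ.+ L
      cancel = solve-∀

    AA-ℤ : + A (A n) ≡ offsetAA a ℤ.+ (+ 3 ℤ.* + n ℤ.- + A n)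
    AA-ℤ = A-unique (A-positive n≥1) (reflect-into _ κ<0 (δ-κ (+ n) (+ A n) 0ℤ (offsetAA a)) AA-fits placed)

    AA-next-ℤ : + A (A (suc n)) ≡ (offsetAA a ℤ.+ + lam a) ℤ.+ (+ 3 ℤ.* + n ℤ.- + A n)
    AA-next-ℤ = A-unique (A-positive (s≤s z≤n))
      (subst (λ x → IsFloor x ((offsetAA a ℤ.+ + lam a) ℤ.+ (+ 3 ℤ.* + n ℤ.- + A n))) (sym A-next-ℤ)
        (reflect-into _ κ<0 (δ-κ (+ n) (+ A n) (jump a) (offsetAA a ℤ.+ + lam a)) AA-next-fits placed))

    AA-next : A (A (suc n)) ≡ A (A n) + lam a
    AA-next = ℤₚ.+-injective (trans AA-next-ℤ
      (trans (swap (offsetAA a) (+ lam a) _) (cong (λ s → s ℤ.+ + lam a) (sym AA-ℤ))))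
      where
      swap : ∀ c l X → (c ℤ.+ l) ℤ.+ X ≡ (c ℤ.+ X) ℤ.+ l
      swap = solve-∀

    block-from : ∀ j w p → p + 2 ≡ j + (2 * n + A n) → FitsBlock a j w → AllPlaced p w
    block-from j []      p _  _ = tt
    block-from j (b ∷ w) p p≡ (image-fits , b-floor , rest) =
      subst (λ y → Between (interval b) (δ (+ p) y)) (sym A-p) image ,
      block-from (suc j) w (suc p) (cong suc p≡) rest
      where
      y = offsetBlock j ℤ.+ (+ 3 ℤ.* + n ℤ.+ + A n)
      2δ : ι (+ 2) ⊗ δ (+ p) y ≡ μ ⊗ δ (+ n) (+ A n) ⊕ ι (+ 2) ⊗ δ (+ j ℤ.- + 2) (offsetBlock j)
      2δ = subst (λ x → ι (+ 2) ⊗ δ x y ≡ μ ⊗ δ (+ n) (+ A n) ⊕ ι (+ 2) ⊗ δ (+ j ℤ.- + 2) (offsetBlock j))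
                 (sym (position-ℤ p j n (A n) p≡))
                 (δ-μ (+ n) (+ A n) (+ j ℤ.- + 2) (offsetBlock j))
      image : Between (interval b) (δ (+ p) y)
      image = reflect-into _ μ<0 2δ image-fits placed
      A-p : + A p ≡ y
      A-p = A-unique (position-positive p j n (A n) n≥1 (A-positive n≥1) p≡) (between-⊆ b-floor image)

    block : ∀ q → q + 2 ≡ 2 * n + A n → AllPlaced q (θ a)
    block q q≡ = block-from 0 (θ a) q q≡ block-fits

  allPlaced-++ : ∀ {i} u {v} → AllPlaced i u → AllPlaced (i + length u) v → AllPlaced i (u ++ v)
  allPlaced-++ {i} []      {v} _ v-placed = subst (λ j → AllPlaced j v) (ℕₚ.+-identityʳ i) v-placed
  allPlaced-++ {i} (a ∷ u) {v} (a-placed , u-placed) v-placed =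
    a-placed , allPlaced-++ u u-placed (subst (λ j → AllPlaced j v) (ℕₚ.+-suc i (length u)) v-placed)

  allPlaced-θ* : ∀ w {n q} → 1 ≤ n → AllPlaced n w → q + 2 ≡ 2 * n + A n → AllPlaced q (θ* w)
  allPlaced-θ* []      _   _ _ = tt
  allPlaced-θ* (a ∷ w) {n} {q} n≥1 (a-placed , w-placed) q≡ =
    allPlaced-++ (θ a) (Letter.block n≥1 a-placed q q≡)
      (allPlaced-θ* w (s≤s z≤n) w-placed next-start)
    where
    open ≡-Reasoning
    rearrange₁ : ∀ q L → q + L + 2 ≡ (q + 2) + L
    rearrange₁ = ℕ-Solver.solve-∀
    rearrange₂ : ∀ n m → 2 * n + (m + 2) ≡ 2 * suc n + m
    rearrange₂ = ℕ-Solver.solve-∀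
    next-start : q + length (θ a) + 2 ≡ 2 * suc n + A (suc n)
    next-start = begin
      q + length (θ a) + 2         ≡⟨ rearrange₁ q (length (θ a)) ⟩
      (q + 2) + length (θ a)       ≡⟨ cong (_+ length (θ a)) q≡ ⟩
      2 * n + A n + length (θ a)   ≡⟨ ℕₚ.+-assoc (2 * n) (A n) _ ⟩
      2 * n + (A n + length (θ a)) ≡⟨ cong (_+_ (2 * n)) (sym (Letter.A-next n≥1 a-placed)) ⟩
      2 * n + (A (suc n) + 2)      ≡⟨ rearrange₂ n (A (suc n)) ⟩
      2 * suc n + A (suc n)        ∎

  A-1 : A 1 ≡ 1
  A-1 = ℤₚ.+-injective (A-unique (s≤s z≤n) (between (positive?-sound _ _) (positive?-sound _ _)))

  allPlaced-θ^ : ∀ k → AllPlaced 1 (θ^ k [1])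
  allPlaced-θ^ zero =
    subst (λ m → Between (interval 1) (δ (+ 1) (+ m))) (sym A-1)
          (between (positive?-sound _ _) (positive?-sound _ _)) , tt
  allPlaced-θ^ (suc k) = allPlaced-θ* (θ^ k [1]) (s≤s z≤n) (allPlaced-θ^ k) (cong (_+_ 2) (sym A-1))

  allPlaced-lookup : ∀ {i} w → AllPlaced i w → (k : Fin (length w)) → Placed (i + toℕ k) (lookup w k)
  allPlaced-lookup {i} (a ∷ _) (a-placed , _) Fin.zero =
    subst (λ j → Placed j a) (sym (ℕₚ.+-identityʳ i)) a-placed
  allPlaced-lookup {i} (_ ∷ w) (_ , w-placed) (Fin.suc k) =
    subst (λ j → Placed j (lookup w k)) (sym (ℕₚ.+-suc i (toℕ k))) (allPlaced-lookup w w-placed k)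

corollary1 : (A : ℕ → ℕ) → (∀ n → 1 ≤ n → IsFloorNAlpha n (A n)) →
    ∀ (k : ℕ) (i : Fin (length (θ^ k [1]))) →
      A (A (toℕ i + 2)) ≡ A (A (toℕ i + 1)) + lam (lookup (θ^ k [1]) i)
corollary1 A isFloorNAlpha k i rewrite ℕₚ.+-comm (toℕ i) 2 | ℕₚ.+-comm (toℕ i) 1 =
  Letter.AA-next (s≤s z≤n) (allPlaced-lookup (θ^ k [1]) (allPlaced-θ^ k) i)
  where open Floor A isFloorNAlpha
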